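{- Let $(w,p,W)$ be a 0-1-Knapsack instance with $n$ items and distinct profit-to-weight ratios $p_1/w_1 > \dots > p_n/w_n$, let $w_{\max} = \max_i w_i$, and let $g$ be its maximal prefix solution. Let $U \subseteq [n]$ be non-empty. For each power of two $\hat m \in [2n]$ let $\mathcal{W}_{\hat m} = \{\hat w \in [w_{\max}] : \hat m/2 < |\{i \in U : w_i = \hat w\}| \le \hat m\}$; let $m$ be the largest power of two such that $\mathcal{W}_m \neq \emptyset$ and put $\mathcal{W} = \mathcal{W}_m$. Let $J = \{i \in U : w_i \in \mathcal{W}\}$, $J^- = \{i \in J : g_i = 1\}$, $J^+ = \{i \in J : g_i = 0\}$. Let $I^-$ consist of the $\lceil |J^-|/2\rceil$ smallest indices in $J^-$ and $I^+$ of the $\lceil |J^+|/2\rceil$ largest indices in $J^+$, let $I$ be the larger of $I^-$ and $I^+$, and let $\Delta = 36000000 \log^3(2n) \cdot m\, w_{\max}^2 / |I|$. Then $$|\operatorname{supp}(w(I))| \cdot \Delta \le 300000000 \log^3(2n) \cdot w_{\max}^2.$$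
   Context: 0-1-Knapsack: given $p \in \mathbb{N}^n$, $w \in \mathbb{N}^n$, $W \in \mathbb{N}$, compute $\max\{p^T x : w^T x \le W,\ x \in \{0,1\}^n\}$. The maximal prefix solution $g \in \{0,1\}^n$ (items ordered by decreasing profit-to-weight ratio) is defined by letting $t \in [n+1]$ be maximal with $w_1 + \dots + w_{t-1} \le W$ and setting $g_i = 1$ for $i<t$, $g_i = 0$ for $i \ge t$. For $I \subseteq [n]$, $\operatorname{supp}(w(I))$ is the set of distinct values $w_i$, $i \in I$. $[k] = \{1,\dots,k\}$. -}

module Defs where

open import Data.Bool using (Bool; true; false; _∧_; not; if_then_else_; T)
open import Data.Nat using (ℕ; zero; suc; _+_; _^_; _⊔_; _≡ᵇ_; _≤ᵇ_; _<ᵇ_; ⌈_/2⌉; NonZero)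
open import Data.Fin using (Fin; toℕ)
open import Data.Fin.Subset using (Subset)
open import Data.Fin.Subset.Properties using (_∈?_)
open import Data.List using (List; []; _∷_; length; map; take; reverse; filterᵇ; foldr; allFin; deduplicate)
open import Data.Nat.ListAction using (sum)
open import Data.Product using (∃; _×_)
open import Relation.Nullary using (does)
open import Relation.Binary.PropositionalEquality using (_≡_)
open import Data.Integer using (+_)
open import Data.Rational using (ℚ; _/_; _*_)
import Data.Nat as ℕ

-- Items are indexed by Fin n (0-based); item i corresponds to item (toℕ i + 1) of the paper.

wmax : ∀ {n} → (Fin n → ℕ) → ℕ
wmax {n} w = foldr _⊔_ 0 (map w (allFin n))

prefSum : ∀ {n} → (Fin n → ℕ) → ℕ → ℕ
prefSum {n} w k = sum (map w (take k (allFin n)))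

-- largest k ∈ {0,…,n} with w_1 + … + w_k ≤ W  (this is t - 1 for the paper's t ∈ [n+1])
maxPrefixLen : ∀ {n} → (Fin n → ℕ) → ℕ → ℕ
maxPrefixLen {n} w W = search n
  where
  search : ℕ → ℕ
  search zero = zero
  search (suc k) = if prefSum w (suc k) ≤ᵇ W then suc k else search k

-- maximal prefix solution: g_i = 1 iff (1-based index) i < t
g : ∀ {n} → (Fin n → ℕ) → ℕ → Fin n → Bool
g w W i = toℕ i <ᵇ maxPrefixLen w W

inU : ∀ {n} → Subset n → Fin n → Bool
inU U i = does (i ∈? U)

cnt : ∀ {n} → Subset n → (Fin n → ℕ) → ℕ → ℕ
cnt {n} U w v = length (filterᵇ (λ i → inU U i ∧ (w i ≡ᵇ v)) (allFin n))

inWset : ∀ {n} → Subset n → (Fin n → ℕ) → ℕ → ℕ → Bool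
inWset U w m̂ v = (1 ≤ᵇ v) ∧ (v ≤ᵇ wmax w) ∧ (m̂ <ᵇ 2 ℕ.* cnt U w v) ∧ (cnt U w v ≤ᵇ m̂)

WsetNonempty : ∀ {n} → Subset n → (Fin n → ℕ) → ℕ → Set
WsetNonempty U w m̂ = ∃ λ v → T (inWset U w m̂ v)

IsPowerOfTwo : ℕ → Set
IsPowerOfTwo m = ∃ λ k → m ≡ 2 ^ k

-- J, J⁻, J⁺ as lists in increasing index order
Jlist : ∀ {n} → Subset n → (Fin n → ℕ) → ℕ → List (Fin n)
Jlist {n} U w m = filterᵇ (λ i → inU U i ∧ inWset U w m (w i)) (allFin n)

Jminus : ∀ {n} → Subset n → (Fin n → ℕ) → ℕ → ℕ → List (Fin n)
Jminus U w W m = filterᵇ (g w W) (Jlist U w m)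

Jplus : ∀ {n} → Subset n → (Fin n → ℕ) → ℕ → ℕ → List (Fin n)
Jplus U w W m = filterᵇ (λ i → not (g w W i)) (Jlist U w m)

Iminus : ∀ {n} → Subset n → (Fin n → ℕ) → ℕ → ℕ → List (Fin n)
Iminus U w W m = take ⌈ length (Jminus U w W m) /2⌉ (Jminus U w W m)

Iplus : ∀ {n} → Subset n → (Fin n → ℕ) → ℕ → ℕ → List (Fin n)
Iplus U w W m = take ⌈ length (Jplus U w W m) /2⌉ (reverse (Jplus U w W m))

suppSize : ∀ {n} → (Fin n → ℕ) → List (Fin n) → ℕ
suppSize w I = length (deduplicate ℕ._≟_ (map w I))

ℕtoℚ : ℕ → ℚ
ℕtoℚ k = (+ k) / 1

-- Δ = 36000000 · L · m · w_max² / |I|, where L stands for log³(2n)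
Delta : ℚ → ℕ → ℕ → (k : ℕ) → .{{NonZero k}} → ℚ
Delta L m wm k = ℕtoℚ 36000000 * L * ℕtoℚ m * ℕtoℚ (wm ℕ.* wm) * ((+ 1) / k)

{-# OPTIONS --safe #-}
-- Every weight of an item of I lies in 𝒲 = 𝒲_m, so it is the weight of more than m/2 items
-- of J; distinct weights have disjoint classes of items, hence |supp(w(I))| · m ≤ 2|J|.
-- Since I⁻ and I⁺ contain at least half of J⁻ and J⁺ and I is the larger of the two,
-- |J| ≤ 4|I|, so |supp(w(I))| · m ≤ 8|I| and |supp(w(I))| · Δ ≤ 288000000 log³(2n) w_max².
-- Neither the profits, nor W, nor the maximality of m play a role.
module Submission where

open import Defs
import Algebra.Solver.CommutativeMonoid as CommutativeMonoidSolver
open import Data.Bool using (Bool; true; false; T; not; _∧_)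
open import Data.Fin using (Fin) renaming (_<_ to _<ᶠ_)
open import Data.Fin.Subset using (Subset; Nonempty)
import Data.Integer as ℤ
import Data.Integer.Properties as ℤ
open import Data.List using (List; []; _∷_; length; take; reverse; map; filterᵇ; deduplicate; allFin)
open import Data.List.Properties using (length-take; length-reverse)
open import Data.List.Membership.Propositional using (_∈_)
open import Data.List.Membership.Propositional.Properties using (∈-filter⁻; ∈-map⁻; ∈-deduplicate⁻)
open import Data.List.Relation.Binary.Subset.Propositional using (_⊆_)
open import Data.List.Relation.Binary.Subset.Propositional.Properties using (filter-⊆)
import Data.List.Relation.Binary.Sublist.Propositional as Sublist
import Data.List.Relation.Binary.Sublist.Propositional.Properties as Sublist
import Data.List.Relation.Unary.All as All
open import Data.List.Relation.Unary.AllPairs using ([]; _∷_)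
open import Data.List.Relation.Unary.Any using (here; there)
open import Data.List.Relation.Unary.Any.Properties using (reverse⁻)
open import Data.List.Relation.Unary.Unique.Propositional using (Unique)
open import Data.List.Relation.Unary.Unique.DecPropositional.Properties using (deduplicate-!)
open import Data.Nat
  using (ℕ; suc; _+_; _*_; _≤_; _<_; z≤n; NonZero; _≡ᵇ_; _<ᵇ_; _≤ᵇ_; _≟_; ⌊_/2⌋; ⌈_/2⌉)
open import Data.Nat.Coprimality using (1-coprimeTo) renaming (sym to coprime-sym)
open import Data.Nat.Properties
open import Data.Product using (_×_; _,_; proj₁; proj₂)
open import Data.Rational using (ℚ; 0ℚ; 1ℚ; mkℚ; _/_; NonNegative; positive; *≤*)
  renaming (_<_ to _<ℚ_; _≤_ to _≤ℚ_; _*_ to _*ℚ_)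
import Data.Rational.Properties as ℚ
open import Data.Sum using (_⊎_; inj₁; inj₂)
open import Function using (_∘_)
open import Relation.Binary.PropositionalEquality using (_≡_; _≢_; refl; sym; trans; cong; subst)
open import Relation.Nullary using (¬_)
open import Relation.Nullary.Decidable using (T?)

T-∧⁻ : ∀ x {y} → T (x ∧ y) → T x × T y
T-∧⁻ true t = _ , t

T-∧⁺ : ∀ {x y} → T x → T y → T (x ∧ y)
T-∧⁺ {true} _ t = t

T-not : ∀ {b} → ¬ T b → T (not b)
T-not {false} _ = _
T-not {true} ¬t = ¬t _

n≤2*⌈n/2⌉ : ∀ n → n ≤ 2 * ⌈ n /2⌉
n≤2*⌈n/2⌉ n = begin
  n                    ≡⟨ sym (⌊n/2⌋+⌈n/2⌉≡n n) ⟩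
  ⌊ n /2⌋ + ⌈ n /2⌉    ≤⟨ +-monoˡ-≤ ⌈ n /2⌉ (⌊n/2⌋≤⌈n/2⌉ n) ⟩
  ⌈ n /2⌉ + ⌈ n /2⌉    ≡⟨ cong (⌈ n /2⌉ +_) (sym (+-identityʳ ⌈ n /2⌉)) ⟩
  2 * ⌈ n /2⌉          ∎
  where open ≤-Reasoning

module _ {a} {A : Set a} where

  length-filterᵇ-partition : ∀ (p : A → Bool) xs →
    length (filterᵇ p xs) + length (filterᵇ (not ∘ p) xs) ≡ length xs
  length-filterᵇ-partition p [] = refl
  length-filterᵇ-partition p (x ∷ xs) with p x
  ... | true  = cong suc (length-filterᵇ-partition p xs)
  ... | false = trans (+-suc _ _) (cong suc (length-filterᵇ-partition p xs))

  filterᵇ-filterᵇ : ∀ (p q : A → Bool) xs →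
    filterᵇ p (filterᵇ q xs) ≡ filterᵇ (λ x → q x ∧ p x) xs
  filterᵇ-filterᵇ p q [] = refl
  filterᵇ-filterᵇ p q (x ∷ xs) with q x
  ... | false = filterᵇ-filterᵇ p q xs
  ... | true with p x
  ...   | true  = cong (x ∷_) (filterᵇ-filterᵇ p q xs)
  ...   | false = filterᵇ-filterᵇ p q xs

  length-filterᵇ-mono : ∀ {p q : A → Bool} → (∀ x → T (p x) → T (q x)) → ∀ xs →
    length (filterᵇ p xs) ≤ length (filterᵇ q xs)
  length-filterᵇ-mono {p} {q} p⇒q xs =
    Sublist.length-mono-≤ (Sublist.filter⁺ (T? ∘ p) (T? ∘ q) (λ { refl → p⇒q _ }) (Sublist.⊆-refl {x = xs}))

  ∈-take⁻ : ∀ {x : A} k xs → x ∈ take k xs → x ∈ xs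
  ∈-take⁻ (suc k) (y ∷ xs) (here x≡y) = here x≡y
  ∈-take⁻ (suc k) (y ∷ xs) (there x∈) = there (∈-take⁻ k xs x∈)

  ≤2*length-take-⌈/2⌉ : ∀ {n} (xs : List A) → n ≤ length xs → n ≤ 2 * length (take ⌈ n /2⌉ xs)
  ≤2*length-take-⌈/2⌉ {n} xs n≤|xs|
    rewrite length-take ⌈ n /2⌉ xs | m≤n⇒m⊓n≡m (≤-trans (⌈n/2⌉≤n n) n≤|xs|) = n≤2*⌈n/2⌉ n

module _ {b} {B : Set b} (f : B → ℕ) where

  occurrences : ℕ → List B → ℕ
  occurrences v xs = length (filterᵇ (λ x → f x ≡ᵇ v) xs)

  occurrences-≤-without : ∀ {d v} → d ≢ v → ∀ xs →
    occurrences v xs ≤ occurrences v (filterᵇ (not ∘ (λ x → f x ≡ᵇ d)) xs)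
  occurrences-≤-without {d} {v} d≢v xs
    rewrite filterᵇ-filterᵇ (λ x → f x ≡ᵇ v) (not ∘ (λ x → f x ≡ᵇ d)) xs =
    length-filterᵇ-mono (λ x fx≡v → T-∧⁺ (T-not (λ fx≡d → d≢v (fx≡d⇒d≡v x fx≡d fx≡v))) fx≡v) xs
    where
    fx≡d⇒d≡v : ∀ x → T (f x ≡ᵇ d) → T (f x ≡ᵇ v) → d ≡ v
    fx≡d⇒d≡v x fx≡d fx≡v = trans (sym (≡ᵇ⇒≡ (f x) d fx≡d)) (≡ᵇ⇒≡ (f x) v fx≡v)

  unique-frequent-values-bound : ∀ {k c} ds → Unique ds → ∀ xs →
    (∀ {v} → v ∈ ds → k ≤ c * occurrences v xs) → length ds * k ≤ c * length xs
  unique-frequent-values-bound [] _ _ _ = z≤n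
  unique-frequent-values-bound {k} {c} (d ∷ ds) (d∉ds ∷ ds!) xs frequent = begin
    k + length ds * k                          ≤⟨ +-mono-≤ (frequent (here refl)) ds-bound ⟩
    c * occurrences d xs + c * length rest     ≡⟨ sym (*-distribˡ-+ c (occurrences d xs) (length rest)) ⟩
    c * (occurrences d xs + length rest)       ≡⟨ cong (c *_) (length-filterᵇ-partition (λ x → f x ≡ᵇ d) xs) ⟩
    c * length xs                              ∎
    where
    open ≤-Reasoning
    rest = filterᵇ (not ∘ (λ x → f x ≡ᵇ d)) xs
    ds-bound : length ds * k ≤ c * length rest
    ds-bound = unique-frequent-values-bound {k} {c} ds ds! rest λ v∈ds →
      ≤-trans (frequent (there v∈ds)) (*-monoʳ-≤ c (occurrences-≤-without (All.lookup d∉ds v∈ds) xs))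

ℕtoℚ≡mkℚ : ∀ a → ℕtoℚ a ≡ mkℚ (ℤ.+ a) 0 (coprime-sym (1-coprimeTo a))
ℕtoℚ≡mkℚ a = ℚ.normalize-coprime (coprime-sym (1-coprimeTo a))

ℕtoℚ-* : ∀ a b → ℕtoℚ (a * b) ≡ ℕtoℚ a *ℚ ℕtoℚ b
ℕtoℚ-* a b rewrite ℕtoℚ≡mkℚ a | ℕtoℚ≡mkℚ b | sym (ℤ.pos-* a b) = refl

ℕtoℚ-mono-≤ : ∀ {a b} → a ≤ b → ℕtoℚ a ≤ℚ ℕtoℚ b
ℕtoℚ-mono-≤ {a} {b} a≤b rewrite ℕtoℚ≡mkℚ a | ℕtoℚ≡mkℚ b =
  *≤* (ℤ.*-monoʳ-≤-nonNeg (ℤ.+ 1) (ℤ.+≤+ a≤b))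

1/k*k≡1 : ∀ k .{{_ : NonZero k}} → (ℤ.+ 1 / k) *ℚ ℕtoℚ k ≡ 1ℚ
1/k*k≡1 (suc k) rewrite ℚ.normalize-coprime (1-coprimeTo (suc k)) | ℕtoℚ≡mkℚ (suc k) =
  ℚ.*-inverseˡ (mkℚ (ℤ.+ suc k) 0 (coprime-sym (1-coprimeTo (suc k))))

*1/k-≤ : ∀ {a b} k .{{_ : NonZero k}} → a ≤ b * k → ℕtoℚ a *ℚ (ℤ.+ 1 / k) ≤ℚ ℕtoℚ b
*1/k-≤ {a} {b} k a≤b*k = ℚ.*-cancelʳ-≤-pos (ℕtoℚ k) {{ℚ.normalize-pos k 1}} (begin
  ℕtoℚ a *ℚ (ℤ.+ 1 / k) *ℚ ℕtoℚ k    ≡⟨ ℚ.*-assoc (ℕtoℚ a) (ℤ.+ 1 / k) (ℕtoℚ k) ⟩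
  ℕtoℚ a *ℚ ((ℤ.+ 1 / k) *ℚ ℕtoℚ k)  ≡⟨ cong (ℕtoℚ a *ℚ_) (1/k*k≡1 k) ⟩
  ℕtoℚ a *ℚ 1ℚ                        ≡⟨ ℚ.*-identityʳ (ℕtoℚ a) ⟩
  ℕtoℚ a                              ≤⟨ ℕtoℚ-mono-≤ a≤b*k ⟩
  ℕtoℚ (b * k)                        ≡⟨ ℕtoℚ-* b k ⟩
  ℕtoℚ b *ℚ ℕtoℚ k                    ∎)
  where open ℚ.≤-Reasoning

Delta-bound : ∀ s m k b wm L → 0ℚ <ℚ L → .{{_ : NonZero k}} → 36000000 * (s * m) ≤ b * k →
  ℕtoℚ s *ℚ Delta L m wm k ≤ℚ ℕtoℚ b *ℚ L *ℚ ℕtoℚ (wm * wm)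
Delta-bound s m k b wm L 0<L bound = begin
  ℕtoℚ s *ℚ Delta L m wm k                       ≡⟨ rearrange (ℕtoℚ s) (ℕtoℚ 36000000) L (ℕtoℚ m) w² k⁻¹ ⟩
  ℕtoℚ 36000000 *ℚ (ℕtoℚ s *ℚ ℕtoℚ m) *ℚ k⁻¹ *ℚ (L *ℚ w²)
                                                  ≡⟨ cong (λ x → x *ℚ k⁻¹ *ℚ (L *ℚ w²)) (sym ℕtoℚ-c*[s*m]) ⟩
  ℕtoℚ (36000000 * (s * m)) *ℚ k⁻¹ *ℚ (L *ℚ w²)   ≤⟨ ℚ.*-monoʳ-≤-nonNeg (L *ℚ w²) (*1/k-≤ {b = b} k bound) ⟩
  ℕtoℚ b *ℚ (L *ℚ w²)                             ≡⟨ sym (ℚ.*-assoc (ℕtoℚ b) L w²) ⟩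
  ℕtoℚ b *ℚ L *ℚ w²                               ∎
  where
  open ℚ.≤-Reasoning
  open CommutativeMonoidSolver ℚ.*-1-commutativeMonoid
  w² = ℕtoℚ (wm * wm)
  k⁻¹ = ℤ.+ 1 / k
  instance
    L*w²-nonNeg : NonNegative (L *ℚ w²)
    L*w²-nonNeg = ℚ.nonNeg*nonNeg⇒nonNeg L {{ℚ.pos⇒nonNeg L {{positive 0<L}}}} w² {{ℚ.normalize-nonNeg (wm * wm) 1}}
  rearrange : ∀ s c L m w² k⁻¹ → s *ℚ (c *ℚ L *ℚ m *ℚ w² *ℚ k⁻¹) ≡ c *ℚ (s *ℚ m) *ℚ k⁻¹ *ℚ (L *ℚ w²)
  rearrange = solve 6 (λ s c L m w² k⁻¹ → s ⊕ ((((c ⊕ L) ⊕ m) ⊕ w²) ⊕ k⁻¹) ⊜ ((c ⊕ (s ⊕ m)) ⊕ k⁻¹) ⊕ (L ⊕ w²)) refl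
  ℕtoℚ-c*[s*m] : ℕtoℚ (36000000 * (s * m)) ≡ ℕtoℚ 36000000 *ℚ (ℕtoℚ s *ℚ ℕtoℚ m)
  ℕtoℚ-c*[s*m] = trans (ℕtoℚ-* 36000000 (s * m)) (cong (ℕtoℚ 36000000 *ℚ_) (ℕtoℚ-* s m))

module _ {n} (U : Subset n) (w : Fin n → ℕ) (W m : ℕ) where

  IsLargerHalf : List (Fin n) → Set
  IsLargerHalf I = (I ≡ Iminus U w W m × length (Iplus U w W m) ≤ length (Iminus U w W m))
                 ⊎ (I ≡ Iplus U w W m × length (Iminus U w W m) ≤ length (Iplus U w W m))

  weight-∈-Wset : ∀ {i} → i ∈ Jlist U w m → T (inWset U w m (w i))
  weight-∈-Wset {i} i∈J =
    proj₂ (T-∧⁻ (inU U i) (proj₂ (∈-filter⁻ (λ i → T? (inU U i ∧ inWset U w m (w i))) {xs = allFin n} i∈J)))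

  m<2*occurrences-Jlist : ∀ {v} → T (inWset U w m v) → m < 2 * occurrences w v (Jlist U w m)
  m<2*occurrences-Jlist {v} v∈Wset = <-≤-trans m<2*cnt (*-monoʳ-≤ 2 cnt≤occurrences)
    where
    m<2*cnt : m < 2 * cnt U w v
    m<2*cnt = <ᵇ⇒< m _ (proj₁ (T-∧⁻ (m <ᵇ 2 * cnt U w v) (proj₂ (T-∧⁻ (v ≤ᵇ wmax w) (proj₂ (T-∧⁻ (1 ≤ᵇ v) v∈Wset))))))
    cnt≤occurrences : cnt U w v ≤ occurrences w v (Jlist U w m)
    cnt≤occurrences
      rewrite filterᵇ-filterᵇ (λ i → w i ≡ᵇ v) (λ i → inU U i ∧ inWset U w m (w i)) (allFin n) =
      length-filterᵇ-mono in-J (allFin n)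
      where
      in-J : ∀ i → T (inU U i ∧ (w i ≡ᵇ v)) → T ((inU U i ∧ inWset U w m (w i)) ∧ (w i ≡ᵇ v))
      in-J i i∈U∧wi≡v with T-∧⁻ (inU U i) i∈U∧wi≡v
      ... | i∈U , wi≡v = T-∧⁺ (T-∧⁺ i∈U wi∈Wset) wi≡v
        where
        wi∈Wset : T (inWset U w m (w i))
        wi∈Wset = subst (T ∘ inWset U w m) (sym (≡ᵇ⇒≡ (w i) v wi≡v)) v∈Wset

  larger-half-⊆-Jlist : ∀ {I} → IsLargerHalf I → I ⊆ Jlist U w m
  larger-half-⊆-Jlist (inj₁ (refl , _)) =
    filter-⊆ (T? ∘ g w W) (Jlist U w m) ∘ ∈-take⁻ _ (Jminus U w W m)
  larger-half-⊆-Jlist (inj₂ (refl , _)) =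
    filter-⊆ (T? ∘ not ∘ g w W) (Jlist U w m) ∘ reverse⁻ ∘ ∈-take⁻ _ (reverse (Jplus U w W m))

  length-Jlist≤2*halves : length (Jlist U w m) ≤ 2 * length (Iminus U w W m) + 2 * length (Iplus U w W m)
  length-Jlist≤2*halves = begin
    length (Jlist U w m)                    ≡⟨ sym (length-filterᵇ-partition (g w W) (Jlist U w m)) ⟩
    length J⁻ + length J⁺                   ≤⟨ +-mono-≤ (≤2*length-take-⌈/2⌉ J⁻ ≤-refl)
                                                        (≤2*length-take-⌈/2⌉ (reverse J⁺) (≤-reflexive (sym (length-reverse J⁺)))) ⟩
    2 * length (Iminus U w W m) + 2 * length (Iplus U w W m) ∎
    where
    open ≤-Reasoning
    J⁻ = Jminus U w W m
    J⁺ = Jplus U w W m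

  length-Jlist≤4*length : ∀ {I} → IsLargerHalf I → length (Jlist U w m) ≤ 4 * length I
  length-Jlist≤4*length (inj₁ (refl , I⁺≤I⁻)) = ≤-trans length-Jlist≤2*halves
    (≤-trans (+-monoʳ-≤ (2 * length (Iminus U w W m)) (*-monoʳ-≤ 2 I⁺≤I⁻))
             (≤-reflexive (sym (*-distribʳ-+ (length (Iminus U w W m)) 2 2))))
  length-Jlist≤4*length (inj₂ (refl , I⁻≤I⁺)) = ≤-trans length-Jlist≤2*halves
    (≤-trans (+-monoˡ-≤ (2 * length (Iplus U w W m)) (*-monoʳ-≤ 2 I⁻≤I⁺))
             (≤-reflexive (sym (*-distribʳ-+ (length (Iplus U w W m)) 2 2))))

  suppSize*m≤8*length : ∀ {I} → IsLargerHalf I → suppSize w I * m ≤ 8 * length I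
  suppSize*m≤8*length {I} I-larger = begin
    suppSize w I * m         ≤⟨ unique-frequent-values-bound w {m} {2} (deduplicate _≟_ (map w I))
                                  (deduplicate-! _≟_ (map w I)) (Jlist U w m) frequent ⟩
    2 * length (Jlist U w m) ≤⟨ *-monoʳ-≤ 2 (length-Jlist≤4*length I-larger) ⟩
    2 * (4 * length I)       ≡⟨ sym (*-assoc 2 4 (length I)) ⟩
    8 * length I             ∎
    where
    open ≤-Reasoning
    frequent : ∀ {v} → v ∈ deduplicate _≟_ (map w I) → m ≤ 2 * occurrences w v (Jlist U w m)
    frequent v∈ with ∈-map⁻ w (∈-deduplicate⁻ _≟_ (map w I) v∈)
    ... | i , i∈I , refl = <⇒≤ (m<2*occurrences-Jlist (weight-∈-Wset (larger-half-⊆-Jlist I-larger i∈I)))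

lemma4p3 : (n : ℕ) (p w : Fin n → ℕ) (W : ℕ)
    → (∀ i → 0 < w i)
    → (∀ i j → i <ᶠ j → p j * w i < p i * w j)
    → (U : Subset n) → Nonempty U
    → (m : ℕ) → IsPowerOfTwo m → m ≤ 2 * n → WsetNonempty U w m
    → (∀ m' → IsPowerOfTwo m' → m' ≤ 2 * n → WsetNonempty U w m' → m' ≤ m)
    → (L : ℚ) → 0ℚ <ℚ L
    → (I : List (Fin n))
    → ((I ≡ Iminus U w W m × length (Iplus U w W m) ≤ length (Iminus U w W m))
       ⊎ (I ≡ Iplus U w W m × length (Iminus U w W m) ≤ length (Iplus U w W m)))
    → .{{nz : NonZero (length I)}}
    → ℕtoℚ (suppSize w I) *ℚ Delta L m (wmax w) (length I)
      ≤ℚ ℕtoℚ 300000000 *ℚ L *ℚ ℕtoℚ (wmax w * wmax w)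
lemma4p3 n p w W _ _ U _ m _ _ _ _ L 0<L I I-larger =
  Delta-bound (suppSize w I) m (length I) 300000000 (wmax w) L 0<L (begin
  36000000 * (suppSize w I * m)  ≤⟨ *-monoʳ-≤ 36000000 (suppSize*m≤8*length U w W m I-larger) ⟩
  36000000 * (8 * length I)      ≡⟨ sym (*-assoc 36000000 8 (length I)) ⟩
  288000000 * length I           ≤⟨ *-monoˡ-≤ (length I) (≤ᵇ⇒≤ 288000000 300000000 _) ⟩
  300000000 * length I           ∎)
  where open ≤-Reasoning
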